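{- Let $L$ be a $\bar{d}$-regular graph on $\bar{n}$ vertices and $k\in\{1,\dots,\bar{n}-1\}$. Denote by $\mathrm{avg\;deg}(\mathfrak{L}_k)$ the average degree of $\mathfrak{L}_k$, i.e., \begin{equation*} \mathrm{avg\;deg}(\mathfrak{L}_k):=\dfrac{1}{|\mathfrak{V}_k|}\sum_{\mathfrak{v}\in\mathfrak{V}_k}\mathrm{deg}_k(\mathfrak{v}). \end{equation*} The average degree satisfies \begin{equation} \dfrac{\mathrm{avg\;deg}(\mathfrak{L}_k)}{k(\bar{n}-k)}=\dfrac{\bar{d}}{\bar{n}-1}\leq 1. \end{equation}
   Context: For a finite simple connected graph $L=(V,E)$ and $k\in\{1,\dots,|V|-1\}$, the $k$-particle graph $\mathfrak{L}_k=(\mathfrak{V}_k,\mathfrak{E}_k)$ has vertex set $\mathfrak{V}_k$ consisting of all subsets of $V$ of size $k$, and $\langle\mathfrak{v},\mathfrak{w}\rangle\in\mathfrak{E}_k$ if and only if $\mathfrak{v}\triangle\mathfrak{w}=\{v,w\}$ with $\langle v,w\rangle\in E$. $\mathrm{deg}_k(\mathfrak{v})$ is the degree of $\mathfrak{v}$ in $\mathfrak{L}_k$. -}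

module Defs where

open import Data.Nat using (ℕ; zero; suc)
open import Data.Bool using (Bool; true; false; _xor_)
open import Data.Fin using (Fin)
open import Data.Fin.Subset using (Subset; ⁅_⁆; _∪_; ∣_∣)
open import Data.Fin.Properties using (any?)
open import Data.Vec using (Vec; []; _∷_; zipWith; tabulate)
open import Data.Vec.Properties using (≡-dec)
import Data.Bool.Properties as B
open import Data.List using (List; []; _∷_; map; _++_; filter; length)
open import Data.Nat.ListAction using (sum)
open import Data.Product using (Σ; ∃; _×_)
open import Relation.Nullary using (Dec)
open import Relation.Binary.PropositionalEquality using (_≡_)
import Data.Nat as N

record Graph (n : ℕ) : Set where
  field
    adj    : Fin n → Fin n → Bool
    sym    : ∀ v w → adj v w ≡ adj w v
    irrefl : ∀ v → adj v v ≡ false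
open Graph public

data Reach {n : ℕ} (G : Graph n) : Fin n → Fin n → Set where
  here : ∀ {v} → Reach G v v
  step : ∀ {u v w} → adj G u v ≡ true → Reach G v w → Reach G u w

Connected : ∀ {n} → Graph n → Set
Connected G = ∀ v w → Reach G v w

nbhd : ∀ {n} → Graph n → Fin n → Subset n
nbhd G v = tabulate (adj G v)

degree : ∀ {n} → Graph n → Fin n → ℕ
degree G v = ∣ nbhd G v ∣

Regular : ∀ {n} → Graph n → ℕ → Set
Regular G d = ∀ v → degree G v ≡ d

allSubsets : (n : ℕ) → List (Subset n)
allSubsets zero = [] ∷ []
allSubsets (suc n) = map (true ∷_) (allSubsets n) ++ map (false ∷_) (allSubsets n)

kSubsets : (n k : ℕ) → List (Subset n)
kSubsets n k = filter (λ s → ∣ s ∣ N.≟ k) (allSubsets n)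

_△_ : ∀ {n} → Subset n → Subset n → Subset n
p △ q = zipWith _xor_ p q

-- edge relation of the k-particle graph: 𝔳 △ 𝔴 = {v,w} with ⟨v,w⟩ ∈ E
ParticleEdge : ∀ {n} → Graph n → Subset n → Subset n → Set
ParticleEdge G 𝔳 𝔴 =
  ∃ λ v → ∃ λ w → (adj G v w ≡ true) × (𝔳 △ 𝔴 ≡ ⁅ v ⁆ ∪ ⁅ w ⁆)

particleEdge? : ∀ {n} (G : Graph n) 𝔳 𝔴 → Dec (ParticleEdge G 𝔳 𝔴)
particleEdge? G 𝔳 𝔴 =
  any? λ v → any? λ w →
    (adj G v w B.≟ true) Relation.Nullary.×-dec ≡-dec B._≟_ (𝔳 △ 𝔴) (⁅ v ⁆ ∪ ⁅ w ⁆)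

degk : ∀ {n} → Graph n → (k : ℕ) → Subset n → ℕ
degk {n} G k 𝔳 = length (filter (particleEdge? G 𝔳) (kSubsets n k))

sumDegk : ∀ {n} → Graph n → ℕ → ℕ
sumDegk {n} G k = sum (map (degk G k) (kSubsets n k))

-- Double counting. An edge 𝔳𝔴 of 𝔏_k arises from exactly two ordered edges (v , w) of L,
-- the two orientations of 𝔳 △ 𝔴, so twice the degree sum counts the triples (𝔳 , 𝔴 , (v , w))
-- with v ~ w and 𝔳 △ 𝔴 = {v , w}. For a fixed ordered edge, 𝔳 must contain exactly one of
-- v and w, and then 𝔴 = 𝔳 △ {v , w}; there are 2 C(n-2, k-1) such 𝔳. Hence the degree sum
-- is n d C(n-2, k-1), and the absorption identities k C(n, k) = n C(n-1, k-1) and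
-- (n-k) C(n-1, k-1) = (n-1) C(n-2, k-1) rewrite it as d k (n-k) C(n, k) / (n-1).
-- Finally d ≤ n-1 because L has no loops.
module Submission where

open import Data.Bool using (Bool; true; false; if_then_else_; _xor_)
import Data.Bool.Properties as B
open import Data.Empty using (⊥-elim)
open import Data.Fin using (Fin; zero; suc)
open import Data.Fin.Properties using () renaming (_≟_ to _≟ᶠ_)
open import Data.Fin.Subset using (Subset; ∣_∣; ⁅_⁆; _∪_; ⊥; _∈_; _∉_)
open import Data.Fin.Subset.Properties
  using (_∈?_; x∈⁅x⁆; x∈⁅y⁆⇒x≡y; x∈p∪q⁻; p⊆p∪q; q⊆p∪q; ∪-comm; ∪-identityˡ; ∣p∣≤n)
open import Data.List using (List; []; _∷_; _++_; map; filter; length)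
open import Data.List.Properties using (map-++; map-∘)
open import Data.Nat using (ℕ; zero; suc; _+_; _*_; _∸_; _≤_; _<_; _≟_; s≤s)
open import Data.Nat.Combinatorics using (_C_; nCk+nC[k+1]≡[n+1]C[k+1]; nC1≡n; nCk≡nC[n∸k])
open import Data.Nat.ListAction using (sum)
open import Data.Nat.ListAction.Properties using (sum-++)
open import Data.Nat.Properties
open import Data.Nat.Tactic.RingSolver using (solve-∀)
open import Algebra.Properties.CommutativeSemigroup +-commutativeSemigroup using (interchange)
open import Algebra.Properties.Semiring.Sum +-*-semiring
  using (sum-syntax; ∑-distrib-+; *-distribˡ-sum; *-distribʳ-sum; sum-cong-≗; sum-replicate-zero)
open import Data.Product using (_×_; _,_)
open import Data.Sum as Sum using (_⊎_; inj₁; inj₂)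
open import Data.Vec using ([]; _∷_; here; there; tabulate)
open import Data.Vec.Properties using (≡-dec; zipWith-identityʳ)
open import Function using (_∘_)
open import Level using (Level)
open import Relation.Binary.PropositionalEquality
open import Relation.Nullary using (Dec; yes; no; does; ¬_; ¬?)
open import Relation.Nullary.Decidable using (dec-true; dec-false)

open import Defs hiding (sym)

private variable
  ℓ : Level
  P Q : Set ℓ

𝟙ᵇ : Bool → ℕ
𝟙ᵇ b = if b then 1 else 0

𝟙 : Dec P → ℕ
𝟙 P? = 𝟙ᵇ (does P?)

𝟙-yes : (P? : Dec P) → P → 𝟙 P? ≡ 1
𝟙-yes P? p = cong 𝟙ᵇ (dec-true P? p)

𝟙-no : (P? : Dec P) → ¬ P → 𝟙 P? ≡ 0
𝟙-no P? ¬p = cong 𝟙ᵇ (dec-false P? ¬p)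

𝟙-cong : (P → Q) → (Q → P) → (P? : Dec P) (Q? : Dec Q) → 𝟙 P? ≡ 𝟙 Q?
𝟙-cong P⇒Q Q⇒P (yes p) Q? = sym (𝟙-yes Q? (P⇒Q p))
𝟙-cong P⇒Q Q⇒P (no ¬p) Q? = sym (𝟙-no Q? (¬p ∘ Q⇒P))

-- Binomial coefficients

[k+1]*[n+1]C[k+1]≡[n+1]*nCk : ∀ n k → suc k * (suc n C suc k) ≡ suc n * (n C k)
[k+1]*[n+1]C[k+1]≡[n+1]*nCk zero    zero    = refl
[k+1]*[n+1]C[k+1]≡[n+1]*nCk zero    (suc k) = *-zeroʳ (suc (suc k))
[k+1]*[n+1]C[k+1]≡[n+1]*nCk (suc n) zero    = begin
  1 * (suc (suc n) C 1) ≡⟨ *-identityˡ _ ⟩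
  suc (suc n) C 1       ≡⟨ nC1≡n (suc (suc n)) ⟩
  suc (suc n)           ≡⟨ *-identityʳ (suc (suc n)) ⟨
  suc (suc n) * 1       ∎
  where open ≡-Reasoning
[k+1]*[n+1]C[k+1]≡[n+1]*nCk (suc n) (suc k) = begin
  suc (suc k) * (suc (suc n) C suc (suc k))
    ≡⟨ cong (suc (suc k) *_) (nCk+nC[k+1]≡[n+1]C[k+1] (suc n) (suc k)) ⟨
  suc (suc k) * (suc n C suc k + suc n C suc (suc k))
    ≡⟨ *-distribˡ-+ (suc (suc k)) (suc n C suc k) _ ⟩
  suc n C suc k + suc k * (suc n C suc k) + suc (suc k) * (suc n C suc (suc k))
    ≡⟨ cong₂ (λ x y → suc n C suc k + x + y)
             ([k+1]*[n+1]C[k+1]≡[n+1]*nCk n k) ([k+1]*[n+1]C[k+1]≡[n+1]*nCk n (suc k)) ⟩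
  suc n C suc k + suc n * (n C k) + suc n * (n C suc k)
    ≡⟨ cong (λ x → x + suc n * (n C k) + suc n * (n C suc k)) (nCk+nC[k+1]≡[n+1]C[k+1] n k) ⟨
  n C k + n C suc k + suc n * (n C k) + suc n * (n C suc k)
    ≡⟨ collect (n C k) (n C suc k) n ⟩
  suc (suc n) * (n C k + n C suc k)
    ≡⟨ cong (suc (suc n) *_) (nCk+nC[k+1]≡[n+1]C[k+1] n k) ⟩
  suc (suc n) * (suc n C suc k) ∎
  where
  open ≡-Reasoning
  collect : ∀ x y n → x + y + suc n * x + suc n * y ≡ suc (suc n) * (x + y)
  collect = solve-∀

[a+b]Ca≡[a+b]Cb : ∀ a b → (a + b) C a ≡ (a + b) C b
[a+b]Ca≡[a+b]Cb a b = trans (nCk≡nC[n∸k] (m≤m+n a b)) (cong ((a + b) C_) (m+n∸m≡n a b))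

[b+1]*[a+b+1]Ca≡[a+b+1]*[a+b]Ca : ∀ a b → suc b * (suc (a + b) C a) ≡ suc (a + b) * ((a + b) C a)
[b+1]*[a+b+1]Ca≡[a+b+1]*[a+b]Ca a b = begin
  suc b * (suc (a + b) C a)       ≡⟨ cong (λ x → suc b * (x C a)) (+-suc a b) ⟨
  suc b * ((a + suc b) C a)       ≡⟨ cong (suc b *_) ([a+b]Ca≡[a+b]Cb a (suc b)) ⟩
  suc b * ((a + suc b) C suc b)   ≡⟨ cong (λ x → suc b * (x C suc b)) (+-suc a b) ⟩
  suc b * (suc (a + b) C suc b)   ≡⟨ [k+1]*[n+1]C[k+1]≡[n+1]*nCk (a + b) b ⟩
  suc (a + b) * ((a + b) C b)     ≡⟨ cong (suc (a + b) *_) ([a+b]Ca≡[a+b]Cb a b) ⟨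
  suc (a + b) * ((a + b) C a)     ∎
  where open ≡-Reasoning

[a+1]*[b+1]*[a+b+2]C[a+1]≡[a+b+2]*[a+b+1]*[a+b]Ca : ∀ a b →
  suc a * suc b * (suc (suc (a + b)) C suc a) ≡ suc (suc (a + b)) * suc (a + b) * ((a + b) C a)
[a+1]*[b+1]*[a+b+2]C[a+1]≡[a+b+2]*[a+b+1]*[a+b]Ca a b = begin
  suc a * suc b * (N C suc a)          ≡⟨ x*y*z≡y*[x*z] (suc a) (suc b) (N C suc a) ⟩
  suc b * (suc a * (N C suc a))        ≡⟨ cong (suc b *_) ([k+1]*[n+1]C[k+1]≡[n+1]*nCk (suc (a + b)) a) ⟩
  suc b * (N * (suc (a + b) C a))      ≡⟨ x*[y*z]≡y*[x*z] (suc b) N (suc (a + b) C a) ⟩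
  N * (suc b * (suc (a + b) C a))      ≡⟨ cong (N *_) ([b+1]*[a+b+1]Ca≡[a+b+1]*[a+b]Ca a b) ⟩
  N * (suc (a + b) * ((a + b) C a))    ≡⟨ *-assoc N (suc (a + b)) _ ⟨
  N * suc (a + b) * ((a + b) C a)      ∎
  where
  open ≡-Reasoning
  N = suc (suc (a + b))
  x*y*z≡y*[x*z] : ∀ x y z → x * y * z ≡ y * (x * z)
  x*y*z≡y*[x*z] = solve-∀
  x*[y*z]≡y*[x*z] : ∀ x y z → x * (y * z) ≡ y * (x * z)
  x*[y*z]≡y*[x*z] = solve-∀

-- Sums over the k-subsets of Fin n

infix 4 _≟ₛ_
_≟ₛ_ : ∀ {n} (s t : Subset n) → Dec (s ≡ t)
_≟ₛ_ = ≡-dec B._≟_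

sumSubsets : (n k : ℕ) → (Subset n → ℕ) → ℕ
sumSubsets zero    zero    f = f []
sumSubsets zero    (suc k) f = 0
sumSubsets (suc n) zero    f = sumSubsets n zero (λ s → f (false ∷ s))
sumSubsets (suc n) (suc k) f =
  sumSubsets n k (λ s → f (true ∷ s)) + sumSubsets n (suc k) (λ s → f (false ∷ s))

infixl 10 sumSubsets
syntax sumSubsets n k (λ s → e) = ∑[ s ⊆ n ∶ k ] e

sumSubsets-cong : ∀ n k {f g : Subset n → ℕ} → (∀ s → ∣ s ∣ ≡ k → f s ≡ g s) →
                  sumSubsets n k f ≡ sumSubsets n k g
sumSubsets-cong zero    zero    f≗g = f≗g [] refl
sumSubsets-cong zero    (suc k) f≗g = refl
sumSubsets-cong (suc n) zero    f≗g = sumSubsets-cong n zero (λ s → f≗g (false ∷ s))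
sumSubsets-cong (suc n) (suc k) f≗g = cong₂ _+_
  (sumSubsets-cong n k (λ s → f≗g (true ∷ s) ∘ cong suc))
  (sumSubsets-cong n (suc k) (λ s → f≗g (false ∷ s)))

sumSubsets-zero : ∀ n k → ∑[ s ⊆ n ∶ k ] 0 ≡ 0
sumSubsets-zero zero    zero    = refl
sumSubsets-zero zero    (suc k) = refl
sumSubsets-zero (suc n) zero    = sumSubsets-zero n zero
sumSubsets-zero (suc n) (suc k) = cong₂ _+_ (sumSubsets-zero n k) (sumSubsets-zero n (suc k))

sumSubsets-distrib-+ : ∀ n k (f g : Subset n → ℕ) →
  ∑[ s ⊆ n ∶ k ] (f s + g s) ≡ sumSubsets n k f + sumSubsets n k g
sumSubsets-distrib-+ zero    zero    f g = refl
sumSubsets-distrib-+ zero    (suc k) f g = refl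
sumSubsets-distrib-+ (suc n) zero    f g = sumSubsets-distrib-+ n zero _ _
sumSubsets-distrib-+ (suc n) (suc k) f g =
  trans (cong₂ _+_ (sumSubsets-distrib-+ n k _ _) (sumSubsets-distrib-+ n (suc k) _ _))
        (interchange (sumSubsets n k (f ∘ (true ∷_))) (sumSubsets n k (g ∘ (true ∷_)))
                     (sumSubsets n (suc k) (f ∘ (false ∷_))) (sumSubsets n (suc k) (g ∘ (false ∷_))))

*-distribˡ-sumSubsets : ∀ n k c (f : Subset n → ℕ) →
  c * sumSubsets n k f ≡ ∑[ s ⊆ n ∶ k ] (c * f s)
*-distribˡ-sumSubsets zero    zero    c f = refl
*-distribˡ-sumSubsets zero    (suc k) c f = *-zeroʳ c
*-distribˡ-sumSubsets (suc n) zero    c f = *-distribˡ-sumSubsets n zero c _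
*-distribˡ-sumSubsets (suc n) (suc k) c f = trans (*-distribˡ-+ c _ _)
  (cong₂ _+_ (*-distribˡ-sumSubsets n k c _) (*-distribˡ-sumSubsets n (suc k) c _))

sumSubsets-one : ∀ n k → ∑[ s ⊆ n ∶ k ] 1 ≡ n C k
sumSubsets-one zero    zero    = refl
sumSubsets-one zero    (suc k) = refl
sumSubsets-one (suc n) zero    = sumSubsets-one n zero
sumSubsets-one (suc n) (suc k) =
  trans (cong₂ _+_ (sumSubsets-one n k) (sumSubsets-one n (suc k))) (nCk+nC[k+1]≡[n+1]C[k+1] n k)

sumSubsets-𝟙≟ : ∀ n k (x : Subset n) → ∑[ t ⊆ n ∶ k ] 𝟙 (t ≟ₛ x) ≡ 𝟙 (∣ x ∣ ≟ k)
sumSubsets-𝟙≟ zero    zero    []        = refl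
sumSubsets-𝟙≟ zero    (suc k) []        = refl
sumSubsets-𝟙≟ (suc n) zero    (true ∷ x)  = sumSubsets-zero n zero
sumSubsets-𝟙≟ (suc n) zero    (false ∷ x) = sumSubsets-𝟙≟ n zero x
sumSubsets-𝟙≟ (suc n) (suc k) (true ∷ x)  =
  trans (cong₂ _+_ (sumSubsets-𝟙≟ n k x) (sumSubsets-zero n (suc k))) (+-identityʳ _)
sumSubsets-𝟙≟ (suc n) (suc k) (false ∷ x) =
  cong₂ _+_ (sumSubsets-zero n k) (sumSubsets-𝟙≟ n (suc k) x)

-- Lists of k-subsets

module _ {A : Set} where

  sum-map-filter : ∀ {P : A → Set} (P? : ∀ x → Dec (P x)) (f : A → ℕ) xs →
    sum (map f (filter P? xs)) ≡ sum (map (λ x → 𝟙 (P? x) * f x) xs)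
  sum-map-filter P? f []       = refl
  sum-map-filter P? f (x ∷ xs) with does (P? x)
  ... | true  = cong₂ _+_ (sym (+-identityʳ (f x))) (sum-map-filter P? f xs)
  ... | false = sum-map-filter P? f xs

  sum-map-0 : (xs : List A) → sum (map (λ _ → 0) xs) ≡ 0
  sum-map-0 []       = refl
  sum-map-0 (_ ∷ xs) = sum-map-0 xs

  length≡sum-map-1 : (xs : List A) → length xs ≡ sum (map (λ _ → 1) xs)
  length≡sum-map-1 []       = refl
  length≡sum-map-1 (x ∷ xs) = cong suc (length≡sum-map-1 xs)

sum-map-allSubsets : ∀ n k (f : Subset n → ℕ) →
  sum (map (λ s → 𝟙 (∣ s ∣ ≟ k) * f s) (allSubsets n)) ≡ sumSubsets n k f
sum-map-allSubsets zero    zero    f = trans (+-identityʳ _) (*-identityˡ (f []))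
sum-map-allSubsets zero    (suc k) f = refl
sum-map-allSubsets (suc n) k       f = begin
  sum (map g (map (true ∷_) (allSubsets n) ++ map (false ∷_) (allSubsets n)))
    ≡⟨ cong sum (map-++ g (map (true ∷_) (allSubsets n)) _) ⟩
  sum (map g (map (true ∷_) (allSubsets n)) ++ map g (map (false ∷_) (allSubsets n)))
    ≡⟨ sum-++ (map g (map (true ∷_) (allSubsets n))) _ ⟩
  sum (map g (map (true ∷_) (allSubsets n))) + sum (map g (map (false ∷_) (allSubsets n)))
    ≡⟨ cong₂ (λ xs ys → sum xs + sum ys) (sym (map-∘ (allSubsets n))) (sym (map-∘ (allSubsets n))) ⟩
  sum (map (g ∘ (true ∷_)) (allSubsets n)) + sum (map (g ∘ (false ∷_)) (allSubsets n))
    ≡⟨ split k ⟩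
  sumSubsets (suc n) k f ∎
  where
  open ≡-Reasoning
  g : Subset (suc n) → ℕ
  g s = 𝟙 (∣ s ∣ ≟ k) * f s
  split : ∀ k → sum (map (λ s → 𝟙 (∣ true ∷ s ∣ ≟ k) * f (true ∷ s)) (allSubsets n))
                + sum (map (λ s → 𝟙 (∣ false ∷ s ∣ ≟ k) * f (false ∷ s)) (allSubsets n))
              ≡ sumSubsets (suc n) k f
  split zero    = cong₂ _+_ (sum-map-0 (allSubsets n)) (sum-map-allSubsets n zero (f ∘ (false ∷_)))
  split (suc k) = cong₂ _+_ (sum-map-allSubsets n k (f ∘ (true ∷_)))
                            (sum-map-allSubsets n (suc k) (f ∘ (false ∷_)))

sum-map-kSubsets : ∀ n k (f : Subset n → ℕ) → sum (map f (kSubsets n k)) ≡ sumSubsets n k f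
sum-map-kSubsets n k f =
  trans (sum-map-filter (λ s → ∣ s ∣ ≟ k) f (allSubsets n)) (sum-map-allSubsets n k f)

length-kSubsets : ∀ n k → length (kSubsets n k) ≡ n C k
length-kSubsets n k = begin
  length (kSubsets n k)               ≡⟨ length≡sum-map-1 (kSubsets n k) ⟩
  sum (map (λ _ → 1) (kSubsets n k))  ≡⟨ sum-map-kSubsets n k (λ _ → 1) ⟩
  ∑[ s ⊆ n ∶ k ] 1                    ≡⟨ sumSubsets-one n k ⟩
  n C k                               ∎
  where open ≡-Reasoning

sumDegk≡sumSubsets : ∀ {n} (G : Graph n) k →
  sumDegk G k ≡ ∑[ s ⊆ n ∶ k ] ∑[ t ⊆ n ∶ k ] 𝟙 (particleEdge? G s t)
sumDegk≡sumSubsets {n} G k =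
  trans (sum-map-kSubsets n k (degk G k)) (sumSubsets-cong n k (λ s _ → degk≡sumSubsets s))
  where
  open ≡-Reasoning
  degk≡sumSubsets : ∀ s → degk G k s ≡ ∑[ t ⊆ n ∶ k ] 𝟙 (particleEdge? G s t)
  degk≡sumSubsets s = begin
    length (filter (particleEdge? G s) (kSubsets n k))
      ≡⟨ length≡sum-map-1 (filter (particleEdge? G s) (kSubsets n k)) ⟩
    sum (map (λ _ → 1) (filter (particleEdge? G s) (kSubsets n k)))
      ≡⟨ sum-map-filter (particleEdge? G s) (λ _ → 1) (kSubsets n k) ⟩
    sum (map (λ t → 𝟙 (particleEdge? G s t) * 1) (kSubsets n k))
      ≡⟨ sum-map-kSubsets n k _ ⟩
    ∑[ t ⊆ n ∶ k ] (𝟙 (particleEdge? G s t) * 1)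
      ≡⟨ sumSubsets-cong n k (λ t _ → *-identityʳ _) ⟩
    ∑[ t ⊆ n ∶ k ] 𝟙 (particleEdge? G s t) ∎

-- Sums over Fin n

∑-const : ∀ n c → ∑[ i < n ] c ≡ n * c
∑-const zero    c = refl
∑-const (suc n) c = cong (c +_) (∑-const n c)

∑-𝟙≟ : ∀ {n} (j : Fin n) → ∑[ i < n ] 𝟙 (i ≟ᶠ j) ≡ 1
∑-𝟙≟ {suc n} zero    = cong suc (sum-replicate-zero n)
∑-𝟙≟ {suc n} (suc j) = ∑-𝟙≟ j

δ² : ∀ {n} (v w v′ w′ : Fin n) → ℕ
δ² v w v′ w′ = 𝟙 (v′ ≟ᶠ v) * 𝟙 (w′ ≟ᶠ w)

∑∑-δ² : ∀ {n} (v w : Fin n) → ∑[ v′ < n ] ∑[ w′ < n ] δ² v w v′ w′ ≡ 1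
∑∑-δ² {n} v w = begin
  ∑[ v′ < n ] ∑[ w′ < n ] (𝟙 (v′ ≟ᶠ v) * 𝟙 (w′ ≟ᶠ w))
    ≡⟨ sum-cong-≗ (λ v′ → *-distribˡ-sum (𝟙 (v′ ≟ᶠ v)) (λ w′ → 𝟙 (w′ ≟ᶠ w))) ⟨
  ∑[ v′ < n ] (𝟙 (v′ ≟ᶠ v) * ∑[ w′ < n ] 𝟙 (w′ ≟ᶠ w))
    ≡⟨ sum-cong-≗ (λ v′ → trans (cong (𝟙 (v′ ≟ᶠ v) *_) (∑-𝟙≟ w)) (*-identityʳ _)) ⟩
  ∑[ v′ < n ] 𝟙 (v′ ≟ᶠ v)
    ≡⟨ ∑-𝟙≟ v ⟩
  1 ∎
  where open ≡-Reasoning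

δ²≡0 : ∀ {n} {v w : Fin n} v′ w′ → ¬ (v′ ≡ v × w′ ≡ w) → δ² v w v′ w′ ≡ 0
δ²≡0 {v = v} {w} v′ w′ ≢ with v′ ≟ᶠ v | w′ ≟ᶠ w
... | yes v′≡v | yes w′≡w = ⊥-elim (≢ (v′≡v , w′≡w))
... | yes _    | no  _    = refl
... | no  _    | _        = refl

sumSubsets-comm : ∀ n k m (f : Subset n → Fin m → ℕ) →
  ∑[ s ⊆ n ∶ k ] ∑[ i < m ] f s i ≡ ∑[ i < m ] ∑[ s ⊆ n ∶ k ] f s i
sumSubsets-comm n k zero    f = sumSubsets-zero n k
sumSubsets-comm n k (suc m) f = trans (sumSubsets-distrib-+ n k _ _)
  (cong (sumSubsets n k (λ s → f s zero) +_) (sumSubsets-comm n k m (λ s i → f s (suc i))))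

sumSubsets-comm₂ : ∀ n k m (f : Subset n → Fin m → Fin m → ℕ) →
  ∑[ s ⊆ n ∶ k ] ∑[ v < m ] ∑[ w < m ] f s v w ≡ ∑[ v < m ] ∑[ w < m ] ∑[ s ⊆ n ∶ k ] f s v w
sumSubsets-comm₂ n k m f =
  trans (sumSubsets-comm n k m _) (sum-cong-≗ (λ v → sumSubsets-comm n k m (λ s w → f s v w)))

-- Pairs and symmetric differences

pair : ∀ {n} → Fin n → Fin n → Subset n
pair v w = ⁅ v ⁆ ∪ ⁅ w ⁆

∈pair⁻ : ∀ {n} {x v w : Fin n} → x ∈ pair v w → x ≡ v ⊎ x ≡ w
∈pair⁻ {v = v} {w} x∈ = Sum.map (x∈⁅y⁆⇒x≡y v) (x∈⁅y⁆⇒x≡y w) (x∈p∪q⁻ ⁅ v ⁆ ⁅ w ⁆ x∈)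

∈pairˡ : ∀ {n} (v w : Fin n) → v ∈ pair v w
∈pairˡ v w = p⊆p∪q ⁅ w ⁆ (x∈⁅x⁆ v)

∈pairʳ : ∀ {n} (v w : Fin n) → w ∈ pair v w
∈pairʳ v w = q⊆p∪q ⁅ v ⁆ ⁅ w ⁆ (x∈⁅x⁆ w)

pair≡pair⁻ : ∀ {n} {v w v′ w′ : Fin n} → v ≢ w → pair v w ≡ pair v′ w′ →
                (v′ ≡ v × w′ ≡ w) ⊎ (v′ ≡ w × w′ ≡ v)
pair≡pair⁻ {v = v} {w} {v′} {w′} v≢w eq
  with ∈pair⁻ (subst (v′ ∈_) (sym eq) (∈pairˡ v′ w′))
... | inj₁ refl with ∈pair⁻ (subst (w ∈_) eq (∈pairʳ v w))
...   | inj₁ refl = ⊥-elim (v≢w refl)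
...   | inj₂ refl = inj₁ (refl , refl)
pair≡pair⁻ {v = v} {w} {v′} {w′} v≢w eq
    | inj₂ refl with ∈pair⁻ (subst (v ∈_) eq (∈pairˡ v w))
...   | inj₁ refl = ⊥-elim (v≢w refl)
...   | inj₂ refl = inj₂ (refl , refl)

pair-comm : ∀ {n} (v w : Fin n) → pair v w ≡ pair w v
pair-comm v w = ∪-comm ⁅ v ⁆ ⁅ w ⁆

pair-zero-suc : ∀ {n} (w : Fin n) → pair zero (suc w) ≡ true ∷ ⁅ w ⁆
pair-zero-suc w = cong (true ∷_) (∪-identityˡ ⁅ w ⁆)

△-cancelˡ : ∀ {n} (s t : Subset n) → s △ (s △ t) ≡ t
△-cancelˡ []      []      = refl
△-cancelˡ (a ∷ s) (b ∷ t) =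
  cong₂ _∷_ (trans (sym (B.xor-assoc a a b)) (cong (_xor b) (B.xor-same a))) (△-cancelˡ s t)

△-identityʳ : ∀ {n} (s : Subset n) → s △ ⊥ ≡ s
△-identityʳ = zipWith-identityʳ B.xor-identityʳ

x∈p⇒∣p△⁅x⁆∣ : ∀ {n} {x : Fin n} {p} → x ∈ p → suc ∣ p △ ⁅ x ⁆ ∣ ≡ ∣ p ∣
x∈p⇒∣p△⁅x⁆∣ {p = true ∷ p} here        = cong (suc ∘ ∣_∣) (△-identityʳ p)
x∈p⇒∣p△⁅x⁆∣ {p = true ∷ p} (there x∈p) = cong suc (x∈p⇒∣p△⁅x⁆∣ x∈p)
x∈p⇒∣p△⁅x⁆∣ {p = false ∷ p} (there x∈p) = x∈p⇒∣p△⁅x⁆∣ x∈p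

x∉p⇒∣p△⁅x⁆∣ : ∀ {n} {x : Fin n} {p} → x ∉ p → ∣ p △ ⁅ x ⁆ ∣ ≡ suc ∣ p ∣
x∉p⇒∣p△⁅x⁆∣ {x = zero}  {true ∷ p}  x∉p = ⊥-elim (x∉p here)
x∉p⇒∣p△⁅x⁆∣ {x = zero}  {false ∷ p} x∉p = cong (suc ∘ ∣_∣) (△-identityʳ p)
x∉p⇒∣p△⁅x⁆∣ {x = suc x} {true ∷ p}  x∉p = cong suc (x∉p⇒∣p△⁅x⁆∣ (x∉p ∘ there))
x∉p⇒∣p△⁅x⁆∣ {x = suc x} {false ∷ p} x∉p = x∉p⇒∣p△⁅x⁆∣ (x∉p ∘ there)

-- Counting k-subsets

count-∉ : ∀ m k (w : Fin (suc m)) → ∑[ s ⊆ suc m ∶ k ] 𝟙 (¬? (w ∈? s)) ≡ m C k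
count-∉ m       zero    zero    = sumSubsets-one m zero
count-∉ m       (suc k) zero    = cong₂ _+_ (sumSubsets-zero m k) (sumSubsets-one m (suc k))
count-∉ (suc m) zero    (suc w) = count-∉ m zero w
count-∉ (suc m) (suc k) (suc w) = trans (cong₂ _+_ (count-∉ m k w) (count-∉ m (suc k) w))
                                        (nCk+nC[k+1]≡[n+1]C[k+1] m k)

count-∈ : ∀ m k (w : Fin (suc m)) → ∑[ s ⊆ suc m ∶ suc k ] 𝟙 (w ∈? s) ≡ m C k
count-∈ m       k       zero    = trans (cong₂ _+_ (sumSubsets-one m k) (sumSubsets-zero m (suc k)))
                                        (+-identityʳ _)
count-∈ (suc m) zero    (suc w) = cong₂ _+_ (none (suc m) w) (count-∈ m zero w)
  where
  none : ∀ n (w : Fin n) → ∑[ s ⊆ n ∶ 0 ] 𝟙 (w ∈? s) ≡ 0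
  none (suc n) zero    = sumSubsets-zero n 0
  none (suc n) (suc w) = none n w
count-∈ (suc m) (suc k) (suc w) = trans (cong₂ _+_ (count-∈ m k w) (count-∈ m (suc k) w))
                                        (nCk+nC[k+1]≡[n+1]C[k+1] m k)

𝟙-∣p△⁅x⁆∣≟suc : ∀ {n k} (x : Fin n) p → ∣ p ∣ ≡ k → 𝟙 (∣ p △ ⁅ x ⁆ ∣ ≟ suc k) ≡ 𝟙 (¬? (x ∈? p))
𝟙-∣p△⁅x⁆∣≟suc x p refl with x ∈? p
... | yes x∈p = 𝟙-no (∣ p △ ⁅ x ⁆ ∣ ≟ suc ∣ p ∣) λ eq →
  m≢1+n+m ∣ p ∣ (trans (sym (x∈p⇒∣p△⁅x⁆∣ x∈p)) (cong suc eq))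
... | no  x∉p = 𝟙-yes (∣ p △ ⁅ x ⁆ ∣ ≟ suc ∣ p ∣) (x∉p⇒∣p△⁅x⁆∣ x∉p)

𝟙-∣p△⁅x⁆∣≟pred : ∀ {n k} (x : Fin n) p → ∣ p ∣ ≡ suc k → 𝟙 (∣ p △ ⁅ x ⁆ ∣ ≟ k) ≡ 𝟙 (x ∈? p)
𝟙-∣p△⁅x⁆∣≟pred {k = k} x p ∣p∣≡1+k with x ∈? p
... | yes x∈p = 𝟙-yes (∣ p △ ⁅ x ⁆ ∣ ≟ k) (suc-injective (trans (x∈p⇒∣p△⁅x⁆∣ x∈p) ∣p∣≡1+k))
... | no  x∉p = 𝟙-no (∣ p △ ⁅ x ⁆ ∣ ≟ k) λ eq →
  m≢1+n+m k (trans (sym eq) (trans (x∉p⇒∣p△⁅x⁆∣ x∉p) (cong suc ∣p∣≡1+k)))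

count-flip-pair₀ : ∀ n (v w : Fin n) → ∑[ s ⊆ n ∶ 0 ] 𝟙 (∣ s △ pair v w ∣ ≟ 0) ≡ 0
count-flip-pair₀ (suc n) zero    zero    = sumSubsets-zero n 0
count-flip-pair₀ (suc n) zero    (suc w) = sumSubsets-zero n 0
count-flip-pair₀ (suc n) (suc v) zero    = sumSubsets-zero n 0
count-flip-pair₀ (suc n) (suc v) (suc w) = count-flip-pair₀ n v w

count-flip-pair : ∀ m j (v w : Fin (suc (suc m))) → v ≢ w →
  ∑[ s ⊆ suc (suc m) ∶ suc j ] 𝟙 (∣ s △ pair v w ∣ ≟ suc j) ≡ 2 * (m C j)
count-flip-pair m j zero zero v≢w = ⊥-elim (v≢w refl)
count-flip-pair m j zero (suc w) _ = begin
  ∑[ s ⊆ suc (suc m) ∶ suc j ] 𝟙 (∣ s △ pair zero (suc w) ∣ ≟ suc j)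
    ≡⟨ cong (λ u → ∑[ s ⊆ suc (suc m) ∶ suc j ] 𝟙 (∣ s △ u ∣ ≟ suc j)) (pair-zero-suc w) ⟩
  (∑[ s ⊆ suc m ∶ j ] 𝟙 (∣ s △ ⁅ w ⁆ ∣ ≟ suc j)) + (∑[ s ⊆ suc m ∶ suc j ] 𝟙 (∣ s △ ⁅ w ⁆ ∣ ≟ j))
    ≡⟨ cong₂ _+_ (sumSubsets-cong (suc m) j (𝟙-∣p△⁅x⁆∣≟suc w))
                 (sumSubsets-cong (suc m) (suc j) (𝟙-∣p△⁅x⁆∣≟pred w)) ⟩
  (∑[ s ⊆ suc m ∶ j ] 𝟙 (¬? (w ∈? s))) + (∑[ s ⊆ suc m ∶ suc j ] 𝟙 (w ∈? s))
    ≡⟨ cong₂ _+_ (count-∉ m j w) (count-∈ m j w) ⟩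
  m C j + m C j
    ≡⟨ cong (m C j +_) (+-identityʳ (m C j)) ⟨
  2 * (m C j) ∎
  where open ≡-Reasoning
count-flip-pair m j (suc v) zero v≢w =
  trans (cong (λ u → ∑[ s ⊆ suc (suc m) ∶ suc j ] 𝟙 (∣ s △ u ∣ ≟ suc j)) (pair-comm (suc v) zero))
        (count-flip-pair m j zero (suc v) (v≢w ∘ sym))
count-flip-pair zero j (suc zero) (suc zero) v≢w = ⊥-elim (v≢w refl)
count-flip-pair (suc m) j (suc v) (suc w) 1+v≢1+w = split j
  where
  v≢w : v ≢ w
  v≢w = 1+v≢1+w ∘ cong suc
  split : ∀ j → (∑[ s ⊆ suc (suc m) ∶ j ] 𝟙 (∣ s △ pair v w ∣ ≟ j))
              + (∑[ s ⊆ suc (suc m) ∶ suc j ] 𝟙 (∣ s △ pair v w ∣ ≟ suc j))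
              ≡ 2 * (suc m C j)
  split zero    = cong₂ _+_ (count-flip-pair₀ (suc (suc m)) v w) (count-flip-pair m zero v w v≢w)
  split (suc i) = begin
    _ ≡⟨ cong₂ _+_ (count-flip-pair m i v w v≢w) (count-flip-pair m (suc i) v w v≢w) ⟩
    2 * (m C i) + 2 * (m C suc i) ≡⟨ *-distribˡ-+ 2 (m C i) (m C suc i) ⟨
    2 * (m C i + m C suc i)   ≡⟨ cong (2 *_) (nCk+nC[k+1]≡[n+1]C[k+1] m i) ⟩
    2 * (suc m C suc i)         ∎
    where open ≡-Reasoning

count-△≡pair : ∀ m j (v w : Fin (suc (suc m))) → v ≢ w →
  ∑[ s ⊆ suc (suc m) ∶ suc j ] ∑[ t ⊆ suc (suc m) ∶ suc j ] 𝟙 (s △ t ≟ₛ pair v w) ≡ 2 * (m C j)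
count-△≡pair m j v w v≢w =
  trans (sumSubsets-cong n k (λ s _ → partner s)) (count-flip-pair m j v w v≢w)
  where
  n = suc (suc m)
  k = suc j
  partner : ∀ s → ∑[ t ⊆ n ∶ k ] 𝟙 (s △ t ≟ₛ pair v w) ≡ 𝟙 (∣ s △ pair v w ∣ ≟ k)
  partner s = trans
    (sumSubsets-cong n k (λ t _ → 𝟙-cong (λ e → trans (sym (△-cancelˡ s t)) (cong (s △_) e))
                                          (λ e → trans (cong (s △_) e) (△-cancelˡ s (pair v w)))
                                          (s △ t ≟ₛ pair v w) (t ≟ₛ s △ pair v w)))
    (sumSubsets-𝟙≟ n k (s △ pair v w))

-- Degrees and double counting

∣tabulate∣ : ∀ {n} (f : Fin n → Bool) → ∣ tabulate f ∣ ≡ ∑[ i < n ] 𝟙ᵇ (f i)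
∣tabulate∣ {zero}  f = refl
∣tabulate∣ {suc n} f with f zero
... | true  = cong suc (∣tabulate∣ (f ∘ suc))
... | false = ∣tabulate∣ (f ∘ suc)

∑∑-adj : ∀ {n d} (G : Graph n) → Regular G d → ∑[ v < n ] ∑[ w < n ] 𝟙ᵇ (adj G v w) ≡ n * d
∑∑-adj {n} {d} G regular =
  trans (sum-cong-≗ (λ v → trans (sym (∣tabulate∣ (adj G v))) (regular v))) (∑-const n d)

regular⇒d≤n∸1 : ∀ {m d} (G : Graph (suc m)) → Regular G d → d ≤ m
regular⇒d≤n∸1 {m} G regular = subst (_≤ m) (regular zero) (no-loop (adj G zero zero) (irrefl G zero))
  where
  no-loop : ∀ b → b ≡ false → ∣ b ∷ tabulate (adj G zero ∘ suc) ∣ ≤ m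
  no-loop false _ = ∣p∣≤n (tabulate (adj G zero ∘ suc))

adj⇒≢ : ∀ {n} (G : Graph n) {v w} → adj G v w ≡ true → v ≢ w
adj⇒≢ G {v} a refl with () ← trans (sym (irrefl G v)) a

𝟙ᵇadj*𝟙pair≟pair : ∀ {n} (G : Graph n) {v w} → adj G v w ≡ true → ∀ v′ w′ →
  𝟙ᵇ (adj G v′ w′) * 𝟙 (pair v w ≟ₛ pair v′ w′) ≡ δ² v w v′ w′ + δ² w v v′ w′
𝟙ᵇadj*𝟙pair≟pair G {v} {w} a v′ w′ with pair v w ≟ₛ pair v′ w′
... | no pair≢ = trans (*-zeroʳ (𝟙ᵇ (adj G v′ w′))) (sym (cong₂ _+_
      (δ²≡0 v′ w′ λ { (refl , refl) → pair≢ refl })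
      (δ²≡0 v′ w′ λ { (refl , refl) → pair≢ (pair-comm v w) })))
... | yes pair≡ with pair≡pair⁻ (adj⇒≢ G a) pair≡
...   | inj₁ (refl , refl)
      rewrite a | 𝟙-yes (v ≟ᶠ v) refl | 𝟙-yes (w ≟ᶠ w) refl | 𝟙-no (v ≟ᶠ w) (adj⇒≢ G a) = refl
...   | inj₂ (refl , refl)
      rewrite Graph.sym G w v | a | 𝟙-yes (v ≟ᶠ v) refl | 𝟙-yes (w ≟ᶠ w) refl
            | 𝟙-no (w ≟ᶠ v) (adj⇒≢ G a ∘ sym) = refl

2*𝟙-particleEdge : ∀ {n} (G : Graph n) s t →
  2 * 𝟙 (particleEdge? G s t) ≡ ∑[ v < n ] ∑[ w < n ] (𝟙ᵇ (adj G v w) * 𝟙 (s △ t ≟ₛ pair v w))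
2*𝟙-particleEdge {n} G s t with particleEdge? G s t
... | yes (v , w , a , s△t≡vw) = sym (begin
  ∑[ v′ < n ] ∑[ w′ < n ] (𝟙ᵇ (adj G v′ w′) * 𝟙 (s △ t ≟ₛ pair v′ w′))
    ≡⟨ sum-cong-≗ (λ v′ → sum-cong-≗ (λ w′ →
         trans (cong (λ u → 𝟙ᵇ (adj G v′ w′) * 𝟙 (u ≟ₛ pair v′ w′)) s△t≡vw)
               (𝟙ᵇadj*𝟙pair≟pair G a v′ w′))) ⟩
  ∑[ v′ < n ] ∑[ w′ < n ] (δ² v w v′ w′ + δ² w v v′ w′)
    ≡⟨ sum-cong-≗ (λ v′ → ∑-distrib-+ (δ² v w v′) (δ² w v v′)) ⟩
  ∑[ v′ < n ] (∑[ w′ < n ] δ² v w v′ w′ + ∑[ w′ < n ] δ² w v v′ w′)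
    ≡⟨ ∑-distrib-+ (λ v′ → ∑[ w′ < n ] δ² v w v′ w′) (λ v′ → ∑[ w′ < n ] δ² w v v′ w′) ⟩
  ∑[ v′ < n ] ∑[ w′ < n ] δ² v w v′ w′ + ∑[ v′ < n ] ∑[ w′ < n ] δ² w v v′ w′
    ≡⟨ cong₂ _+_ (∑∑-δ² v w) (∑∑-δ² w v) ⟩
  2 ∎)
  where open ≡-Reasoning
... | no ¬particleEdge = sym (trans
  (sum-cong-≗ (λ v → trans (sum-cong-≗ (λ w → not-edge v w)) (sum-replicate-zero n)))
  (sum-replicate-zero n))
  where
  not-edge : ∀ v w → 𝟙ᵇ (adj G v w) * 𝟙 (s △ t ≟ₛ pair v w) ≡ 0
  not-edge v w with adj G v w in a
  ... | false = refl
  ... | true  = cong (1 *_) (𝟙-no (s △ t ≟ₛ pair v w) λ e → ¬particleEdge (v , w , a , e))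

double-counting : ∀ {n} (G : Graph n) k →
  2 * sumDegk G k ≡ ∑[ v < n ] ∑[ w < n ]
                      (𝟙ᵇ (adj G v w) * ∑[ s ⊆ n ∶ k ] ∑[ t ⊆ n ∶ k ] 𝟙 (s △ t ≟ₛ pair v w))
double-counting {n} G k = begin
  2 * sumDegk G k
    ≡⟨ cong (2 *_) (sumDegk≡sumSubsets G k) ⟩
  2 * ∑[ s ⊆ n ∶ k ] ∑[ t ⊆ n ∶ k ] 𝟙 (particleEdge? G s t)
    ≡⟨ *-distribˡ-sumSubsets₂ 2 (λ s t → 𝟙 (particleEdge? G s t)) ⟩
  ∑[ s ⊆ n ∶ k ] ∑[ t ⊆ n ∶ k ] (2 * 𝟙 (particleEdge? G s t))
    ≡⟨ sumSubsets-cong n k (λ s _ → sumSubsets-cong n k (λ t _ → 2*𝟙-particleEdge G s t)) ⟩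
  ∑[ s ⊆ n ∶ k ] ∑[ t ⊆ n ∶ k ] ∑[ v < n ] ∑[ w < n ] X s t v w
    ≡⟨ sumSubsets-cong n k (λ s _ → sumSubsets-comm₂ n k n (X s)) ⟩
  ∑[ s ⊆ n ∶ k ] ∑[ v < n ] ∑[ w < n ] ∑[ t ⊆ n ∶ k ] X s t v w
    ≡⟨ sumSubsets-comm₂ n k n (λ s v w → ∑[ t ⊆ n ∶ k ] X s t v w) ⟩
  ∑[ v < n ] ∑[ w < n ] ∑[ s ⊆ n ∶ k ] ∑[ t ⊆ n ∶ k ] X s t v w
    ≡⟨ sum-cong-≗ (λ v → sum-cong-≗ (λ w →
         *-distribˡ-sumSubsets₂ (𝟙ᵇ (adj G v w)) (λ s t → 𝟙 (s △ t ≟ₛ pair v w)))) ⟨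
  ∑[ v < n ] ∑[ w < n ] (𝟙ᵇ (adj G v w) * ∑[ s ⊆ n ∶ k ] ∑[ t ⊆ n ∶ k ] 𝟙 (s △ t ≟ₛ pair v w)) ∎
  where
  open ≡-Reasoning
  X : Subset n → Subset n → Fin n → Fin n → ℕ
  X s t v w = 𝟙ᵇ (adj G v w) * 𝟙 (s △ t ≟ₛ pair v w)
  *-distribˡ-sumSubsets₂ : ∀ c (f : Subset n → Subset n → ℕ) →
    c * ∑[ s ⊆ n ∶ k ] ∑[ t ⊆ n ∶ k ] f s t ≡ ∑[ s ⊆ n ∶ k ] ∑[ t ⊆ n ∶ k ] (c * f s t)
  *-distribˡ-sumSubsets₂ c f = trans (*-distribˡ-sumSubsets n k c _)
    (sumSubsets-cong n k (λ s _ → *-distribˡ-sumSubsets n k c (f s)))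

sumDegk-regular : ∀ m d j (G : Graph (suc (suc m))) → Regular G d →
  sumDegk G (suc j) ≡ suc (suc m) * d * (m C j)
sumDegk-regular m d j G regular = *-cancelˡ-≡ _ _ 2 (begin
  2 * sumDegk G (suc j)
    ≡⟨ double-counting G (suc j) ⟩
  ∑[ v < n ] ∑[ w < n ] (𝟙ᵇ (adj G v w) * ∑[ s ⊆ n ∶ suc j ] ∑[ t ⊆ n ∶ suc j ] 𝟙 (s △ t ≟ₛ pair v w))
    ≡⟨ sum-cong-≗ (λ v → sum-cong-≗ (λ w → edge-contribution v w)) ⟩
  ∑[ v < n ] ∑[ w < n ] (𝟙ᵇ (adj G v w) * c)
    ≡⟨ sum-cong-≗ (λ v → *-distribʳ-sum c (λ w → 𝟙ᵇ (adj G v w))) ⟨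
  ∑[ v < n ] (∑[ w < n ] 𝟙ᵇ (adj G v w) * c)
    ≡⟨ *-distribʳ-sum c (λ v → ∑[ w < n ] 𝟙ᵇ (adj G v w)) ⟨
  ∑[ v < n ] ∑[ w < n ] 𝟙ᵇ (adj G v w) * c
    ≡⟨ cong (_* c) (∑∑-adj G regular) ⟩
  n * d * (2 * (m C j))
    ≡⟨ x*[2*y]≡2*[x*y] (n * d) (m C j) ⟩
  2 * (n * d * (m C j)) ∎)
  where
  open ≡-Reasoning
  n = suc (suc m)
  c = 2 * (m C j)
  edge-contribution : ∀ v w →
    𝟙ᵇ (adj G v w) * ∑[ s ⊆ n ∶ suc j ] ∑[ t ⊆ n ∶ suc j ] 𝟙 (s △ t ≟ₛ pair v w) ≡ 𝟙ᵇ (adj G v w) * c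
  edge-contribution v w with adj G v w in a
  ... | false = refl
  ... | true  = cong (1 *_) (count-△≡pair m j v w (adj⇒≢ G a))
  x*[2*y]≡2*[x*y] : ∀ x y → x * (2 * y) ≡ 2 * (x * y)
  x*[2*y]≡2*[x*y] = solve-∀

sumDegk*[n∸1] : ∀ a b d (G : Graph (suc (suc (a + b)))) → Regular G d →
  sumDegk G (suc a) * suc (a + b) ≡ d * (suc a * suc b) * (suc (suc (a + b)) C suc a)
sumDegk*[n∸1] a b d G regular = begin
  sumDegk G (suc a) * suc (a + b)        ≡⟨ cong (_* suc (a + b)) (sumDegk-regular (a + b) d a G regular) ⟩
  N * d * ((a + b) C a) * suc (a + b)    ≡⟨ rearrange N d ((a + b) C a) (suc (a + b)) ⟩
  d * (N * suc (a + b) * ((a + b) C a))  ≡⟨ cong (d *_) ([a+1]*[b+1]*[a+b+2]C[a+1]≡[a+b+2]*[a+b+1]*[a+b]Ca a b) ⟨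
  d * (suc a * suc b * (N C suc a))      ≡⟨ *-assoc d (suc a * suc b) (N C suc a) ⟨
  d * (suc a * suc b) * (N C suc a)      ∎
  where
  open ≡-Reasoning
  N = suc (suc (a + b))
  rearrange : ∀ n d c m → n * d * c * m ≡ d * (n * m * c)
  rearrange = solve-∀

proposition5p3 : (n d k : ℕ) (G : Graph n) → Connected G → Regular G d →
    1 ≤ k → k < n →
    (sumDegk G k * (n ∸ 1) ≡ d * (k * (n ∸ k)) * length (kSubsets n k)) × (d ≤ n ∸ 1)
proposition5p3 (suc (suc m)) d (suc j) G _ regular _ (s≤s (s≤s j≤m))
  with r , refl ← m≤n⇒∃[o]m+o≡n j≤m =
    trans (sumDegk*[n∸1] j r d G regular)
          (cong₂ (λ x y → d * (suc j * x) * y)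
                 (sym n∸k≡1+r) (sym (length-kSubsets (suc (suc (j + r))) (suc j))))
  , regular⇒d≤n∸1 G regular
  where
  n∸k≡1+r : suc (j + r) ∸ j ≡ suc r
  n∸k≡1+r = trans (cong (_∸ j) (sym (+-suc j r))) (m+n∸m≡n j (suc r))
proposition5p3 (suc zero) d (suc j) _ _ _ _ (s≤s ())
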